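{- Let $D_S=(N_S,A_S\cup H_S)$ be a partially time-expanded network satisfying (P1)–(P4), let $\bar x$ be a feasible solution of $\mathrm{UPR}(D_T)$ and $\hat x=\mu(\bar x)$. Let $v\in N$, let $(v,t)\in N_S$ with $t<T$, let $e=((v,t),(v,\mathtt{n_S}(v,t)))\in H_S$ and $f=((v,t),(v,t+1))\in H_T$. Then $$\sum_{k\in\mathcal{K}^1_{\hat x}(v)}\hat x^k_e\le\sum_{k\in\mathcal{K}^1_{\hat x}(v)}\bar x^k_f+(\mathtt{m_S}(v,t)-1)\,b_v.$$
   Context: Base network: a directed graph $D=(N,A)$; each arc $vw\in A$ has a transit time $\tau_{vw}\in\mathbb{N}$ and a capacity $u_{vw}\in\mathbb{N}$; each node $v\in N$ has a storage capacity $b_v\in\mathbb{N}$. $\mathcal{K}$ is a finite set of packets; packet $k$ has origin $s_k$ and destination $t_k$. For $v\in N$ let $\mathcal{K}_v=\{k\in\mathcal{K}: s_k\ne v,\ t_k\ne v\}$. Fix $T\in\mathbb{N}$, $[T]=\{0,\dots,T\}$. Fully time-expanded network $D_T=(N_T,A_T\cup H_T)$: $N_T=\{(v,t):v\in N,t\in[T]\}$; movement arcs $A_T=\{((v,t),(w,t+\tau_{vw})): (v,t)\in N_T, vw\in A, t+\tau_{vw}\le T\}$; holdover arcs $H_T=\{((v,t),(v,t+1)): v\in N, 0\le t<T\}$. $\mathrm{UPR}(D_T)$ is the integer program with binary variables $x^k_e$ ($k\in\mathcal{K}$, $e\in A_T\cup H_T$) and variable $\bar T$: minimize $\bar T$ s.t.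 $t'x^k_e\le\bar T$ for all $k$, $e=((v,t),(w,t'))\in A_T$; $\sum_{e=((v,t),(w,t'))\in A_T,\,w=t_k}t'x^k_e\le\bar T$ for all $k$; flow conservation for each $k$ at each $(v,t)\in N_T$ (out minus in equals $1$ at $(s_k,0)$, $-1$ at $(t_k,T)$, $0$ otherwise); $\sum_k x^k_e\le u_{vw}$ for each copy $e\in A_T$ of $vw$; $\sum_{k\in\mathcal{K}_v}x^k_e\le b_v$ for each holdover arc $e$ at $v$. A feasible solution gives each packet $k$ a trajectory $Q_k$ (directed path) in $D_T$ from $(s_k,0)$ to $(t_k,T)$. Partially time-expanded network: $N_S\subseteq N_T$; $\mathtt{n_S}(v,t)=\min\{t'>t:(v,t')\in N_S\}$, $\mathtt{m_S}(v,t)=\mathtt{n_S}(v,t)-t$; $H_S$ consists of the arcs $((v,t),(v,\mathtt{n_S}(v,t)))$ for $(v,t)\in N_S$, $t<T$; $A_S$ is a set of arcs $((v,t),(w,t'))$ with both ends in $N_S$ and $vw\in A$. Properties: (P1) $(s_k,0),(t_k,T)\in N_S$ for all $k$; (P2) each $((v,t),(w,t'))\in A_S$ has $t'\le t+\tau_{vw}$; (P3) for each $vw\in A$ and $(v,t)\in N_S$ with $t+\tau_{vw}\le T$, $A_S$ contains a copy of $vw$ starting at $(v,t)$; (P4) if $((v,t),(w,t'))\in A_S$ there is no $(w,t'')\in N_S$ with $t'<t''\le t+\tau_{vw}$. Map $\mu:A_T\to A_S$: $((v,\bar t),(w,\bar t'))\mapsto((v,\hat t),(w,\hat t'))$, $\hat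 t=\max\{t\le\bar t:(v,t)\in N_S\}$, $\hat t'=\max\{t\le\hat t+\tau_{vw}:(w,t)\in N_S\}$. For feasible $\bar x$, $\hat x=\mu(\bar x)$: for each $k$, $\hat x^k$ is the incidence vector of the trajectory in $D_S$ whose movement arcs are the $\mu$-images of the movement arcs of $Q_k$ in order, joined by holdover arcs of $H_S$. For a packet $k$ whose path visits $v$ immediately after node $u$, its movement arc from $u$ to $v$ in $\bar x$ departs $u$ at time $\bar t^{k,out}_u$, and its $\mu$-image departs $u$ at time $\hat t^{k,out}_u\le\bar t^{k,out}_u$. $\mathcal{K}(v)$ is the set of packets in $\mathcal{K}_v$ whose trajectory in $\bar x$ contains a timed copy of $v$; $\mathcal{K}^1_{\hat x}(v)=\{k\in\mathcal{K}(v):\hat t^{k,out}_u=\bar t^{k,out}_u\}$ and $\mathcal{K}^2_{\hat x}(v)=\{k\in\mathcal{K}(v):\hat t^{k,out}_u<\bar t^{k,out}_u\}$. -}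

module Defs where

open import Data.Nat using (ℕ; zero; suc; _+_; _∸_; _*_; _≤_; _<_; _≡ᵇ_)
open import Data.Fin using (Fin) renaming (_≟_ to _≟ᶠ_)
open import Data.Bool using (Bool; true; false; if_then_else_; _∧_; not)
open import Data.List using (List; []; _∷_; _++_)
open import Data.List.Relation.Unary.Unique.Propositional using (Unique)
open import Data.List.Relation.Binary.Pointwise using (Pointwise)
open import Data.Product using (_×_; _,_; ∃)
open import Data.Empty using (⊥)
open import Relation.Binary.PropositionalEquality using (_≡_)
open import Relation.Nullary.Decidable using (⌊_⌋)

Σᶠ : ∀ {K} → (Fin K → ℕ) → ℕ
Σᶠ {zero} f = 0
Σᶠ {suc K} f = f Fin.zero + Σᶠ (λ i → f (Fin.suc i))

countL : ∀ {X : Set} → (X → Bool) → List X → ℕ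
countL p [] = 0
countL p (x ∷ xs) = (if p x then 1 else 0) + countL p xs

record TArc (n : ℕ) : Set where
  constructor tarc
  field
    tail : Fin n
    dep  : ℕ
    head : Fin n
    arr  : ℕ
open TArc public

-- t' = min { s > t : P s }   (i.e. t' = n_S(v,t) for P = NS v)
IsNext : (ℕ → Bool) → ℕ → ℕ → Set
IsNext P t t' = t < t' × P t' ≡ true × (∀ s → t < s → s < t' → P s ≡ false)

IsMaxLE : (ℕ → Bool) → ℕ → ℕ → Set
IsMaxLE P bound t = t ≤ bound × P t ≡ true × (∀ s → t < s → s ≤ bound → P s ≡ false)

-- Base network D=(N,A) with N = Fin n, transit times τ, capacities u, storage b,
-- packets Fin K with origins src and destinations dst, horizon T.
module UPR (n : ℕ) (A : Fin n → Fin n → Set) (τ u : Fin n → Fin n → ℕ) (b : Fin n → ℕ)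
           (K : ℕ) (src dst : Fin K → Fin n) (T : ℕ) where

  data WalkT : Fin n → ℕ → Fin n → ℕ → Set where
    stop : ∀ {v t} → WalkT v t v t
    hold : ∀ {v t z s} → t < T → WalkT v (suc t) z s → WalkT v t z s
    move : ∀ {v t z s} (w : Fin n) → A v w → t + τ v w ≤ T →
           WalkT w (t + τ v w) z s → WalkT v t z s

  nodesT : ∀ {v t z s} → WalkT v t z s → List (Fin n × ℕ)
  nodesT {v} {t} stop = (v , t) ∷ []
  nodesT {v} {t} (hold _ q) = (v , t) ∷ nodesT q
  nodesT {v} {t} (move _ _ _ q) = (v , t) ∷ nodesT q

  movesT : ∀ {v t z s} → WalkT v t z s → List (TArc n)
  movesT stop = []
  movesT (hold _ q) = movesT q
  movesT {v} {t} (move w _ _ q) = tarc v t w (t + τ v w) ∷ movesT q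

  holdsT : ∀ {v t z s} → WalkT v t z s → List (Fin n × ℕ)
  holdsT stop = []
  holdsT {v} {t} (hold _ q) = (v , t) ∷ holdsT q
  holdsT (move _ _ _ q) = holdsT q

  -- x^k_e for the copy e = ((v,t),(w,t+τ_vw)) of vw : incidence of the trajectory
  xMove : ∀ {a r z s} → WalkT a r z s → Fin n → ℕ → Fin n → ℕ
  xMove q v t w = countL (λ e → ⌊ tail e ≟ᶠ v ⌋ ∧ (dep e ≡ᵇ t) ∧ ⌊ head e ≟ᶠ w ⌋) (movesT q)

  xHold : ∀ {a r z s} → WalkT a r z s → Fin n → ℕ → ℕ
  xHold q v t = countL (λ p → ⌊ Data.Product.proj₁ p ≟ᶠ v ⌋ ∧ (Data.Product.proj₂ p ≡ᵇ t)) (holdsT q)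

  inKv : Fin n → Fin K → Bool
  inKv v k = not ⌊ src k ≟ᶠ v ⌋ ∧ not ⌊ dst k ≟ᶠ v ⌋

  Trajectories : Set
  Trajectories = (k : Fin K) → WalkT (src k) 0 (dst k) T

  -- the solution x̄ given by trajectories Q is feasible for UPR(D_T)
  -- (flow conservation holds by construction; T̄ can always be chosen large enough)
  record Feasible (Q : Trajectories) : Set where
    field
      isPath  : ∀ k → Unique (nodesT (Q k))
      arcCap  : ∀ v w t → A v w → t + τ v w ≤ T →
                Σᶠ (λ k → xMove (Q k) v t w) ≤ u v w
      holdCap : ∀ v t → t < T →
                Σᶠ (λ k → if inKv v k then xHold (Q k) v t else 0) ≤ b v

  record PTEN (NS : Fin n → ℕ → Bool) (AS : Fin n → ℕ → Fin n → ℕ → Set) : Set where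
    field
      NS⊆NT  : ∀ v t → NS v t ≡ true → t ≤ T
      AS-arc : ∀ {v t w t'} → AS v t w t' → A v w × NS v t ≡ true × NS w t' ≡ true
      P1 : ∀ k → NS (src k) 0 ≡ true × NS (dst k) T ≡ true
      P2 : ∀ {v t w t'} → AS v t w t' → t' ≤ t + τ v w
      P3 : ∀ v w t → A v w → NS v t ≡ true → t + τ v w ≤ T → ∃ λ t' → AS v t w t'
      P4 : ∀ {v t w t'} → AS v t w t' → ∀ t'' → NS w t'' ≡ true →
           t' < t'' → t'' ≤ t + τ v w → ⊥

  module _ (NS : Fin n → ℕ → Bool) (AS : Fin n → ℕ → Fin n → ℕ → Set) where

    data WalkS : Fin n → ℕ → Fin n → ℕ → Set where
      stop : ∀ {v t} → WalkS v t v t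
      hold : ∀ {v t t' z s} → NS v t ≡ true → t < T → IsNext (NS v) t t' →
             WalkS v t' z s → WalkS v t z s
      move : ∀ {v t z s} (w : Fin n) (t' : ℕ) → AS v t w t' →
             WalkS w t' z s → WalkS v t z s

    movesS : ∀ {v t z s} → WalkS v t z s → List (TArc n)
    movesS stop = []
    movesS (hold _ _ _ q) = movesS q
    movesS {v} {t} (move w t' _ q) = tarc v t w t' ∷ movesS q

    holdsS : ∀ {v t z s} → WalkS v t z s → List (Fin n × ℕ)
    holdsS stop = []
    holdsS {v} {t} (hold _ _ _ q) = (v , t) ∷ holdsS q
    holdsS (move _ _ _ q) = holdsS q

    xHoldS : ∀ {a r z s} → WalkS a r z s → Fin n → ℕ → ℕ
    xHoldS q v t = countL (λ p → ⌊ Data.Product.proj₁ p ≟ᶠ v ⌋ ∧ (Data.Product.proj₂ p ≡ᵇ t)) (holdsS q)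

    MuImage : TArc n → TArc n → Set
    MuImage (tarc v t̄ w t̄') (tarc v' t̂ w' t̂') =
      v' ≡ v × w' ≡ w × IsMaxLE (NS v) t̄ t̂ × IsMaxLE (NS w) (t̂ + τ v w) t̂'

    -- Q̂ = μ(Q): movement arcs of Q̂ are, in order, the μ-images of those of Q
    IsMu : ∀ {a r z s} → WalkT a r z s → WalkS a r z s → Set
    IsMu q q̂ = Pointwise MuImage (movesT q) (movesS q̂)

    exactInto : Fin n → List (TArc n) → List (TArc n) → Bool
    exactInto v (e ∷ es) (ê ∷ ês) =
      (if ⌊ head e ≟ᶠ v ⌋ then dep e ≡ᵇ dep ê else true) ∧ exactInto v es ês
    exactInto v _ _ = true

    visits : Fin n → List (Fin n × ℕ) → Bool
    visits v [] = false
    visits v ((w , _) ∷ ps) = if ⌊ w ≟ᶠ v ⌋ then true else visits v ps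

    inK1 : (Q : Trajectories) → ((k : Fin K) → WalkS (src k) 0 (dst k) T) →
           Fin n → Fin K → Bool
    inK1 Q Q̂ v k = inKv v k ∧ visits v (nodesT (Q k)) ∧ exactInto v (movesT (Q k)) (movesS (Q̂ k))

{-# OPTIONS --safe #-}
-- Follow a packet k ∈ 𝒦¹(v) through Q_k and Q̂_k = μ(Q_k) simultaneously, one movement
-- arc at a time.  Between two consecutive movement arcs both trajectories wait at the same
-- node, Q_k on [r, d) and Q̂_k on [r̂, d̂), where r̂ and d̂ are r and d rounded down to N_S:
-- d̂ by the definition of μ, and r̂ because the previous arc left at the same time in both
-- trajectories (this is where k ∈ 𝒦¹ enters).  Times strictly increase along holdover arcs,
-- so Q̂_k uses e at most once in such a stretch, and if it does then [r, d) meets the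
-- window [t, n_S(v,t)), i.e. Q_k uses a holdover arc of D_T at v starting in that window.
-- Hence x̂^k_e ≤ Σ_{t ≤ s < n_S(v,t)} x̄^k_{(v,s)}; the summand s = t is x̄^k_f, and summing
-- the others over 𝒦_v gives at most m_S(v,t) − 1 full storage capacities b_v.
module Submission where

open import Defs
open import Data.Bool using (Bool; true; false; if_then_else_; _∧_; not)
open import Data.Bool.Properties using (T-≡)
open import Function.Bundles using (Equivalence)
open import Data.Fin using (Fin) renaming (_≟_ to _≟ᶠ_)
open import Data.List using ([]; _∷_)
open import Data.List.Relation.Binary.Pointwise using (Pointwise; []; _∷_)
open import Data.Nat
  using (ℕ; zero; suc; _+_; _∸_; _*_; _≤_; _<_; z≤n; s≤s; z<s; _≡ᵇ_; _≟_; _≤?_; _<?_)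
open import Data.Nat.Properties
open import Algebra.Properties.CommutativeSemigroup +-commutativeSemigroup using (interchange)
open import Data.Product using (_×_; _,_; ∃; proj₁)
open import Function.Base using (_∘_)
open import Relation.Nullary using (¬_; Dec; yes; no; contradiction)
open import Relation.Nullary.Decidable using (⌊_⌋; _×-dec_)
open import Relation.Binary.PropositionalEquality

sumFrom : (ℕ → ℕ) → ℕ → ℕ → ℕ
sumFrom f lo zero = 0
sumFrom f lo (suc m) = f lo + sumFrom f (suc lo) m

sumFrom-mono : ∀ {f g} → (∀ s → f s ≤ g s) → ∀ lo m → sumFrom f lo m ≤ sumFrom g lo m
sumFrom-mono f≤g lo zero = z≤n
sumFrom-mono f≤g lo (suc m) = +-mono-≤ (f≤g lo) (sumFrom-mono f≤g (suc lo) m)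

sumFrom-mono-< : ∀ {f g} → (∀ s → f s ≤ g s) → ∀ {x} lo m → lo ≤ x → x < lo + m →
                 f x < g x → sumFrom f lo m < sumFrom g lo m
sumFrom-mono-< f≤g lo zero lo≤x x<lo+0 =
  contradiction (subst (_ <_) (+-identityʳ lo) x<lo+0) (≤⇒≯ lo≤x)
sumFrom-mono-< f≤g {x} lo (suc m) lo≤x x<lo+m fx<gx with lo ≟ x
... | yes refl = +-mono-<-≤ fx<gx (sumFrom-mono f≤g (suc lo) m)
... | no lo≢x = +-mono-≤-< (f≤g lo)
  (sumFrom-mono-< f≤g (suc lo) m (≤∧≢⇒< lo≤x lo≢x) (subst (x <_) (+-suc lo m) x<lo+m) fx<gx)

sumFrom-≤-* : ∀ {f B} lo m → (∀ i → lo ≤ i → i < lo + m → f i ≤ B) → sumFrom f lo m ≤ m * B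
sumFrom-≤-* lo zero f≤B = z≤n
sumFrom-≤-* lo (suc m) f≤B = +-mono-≤ (f≤B lo ≤-refl (m<m+n lo z<s))
  (sumFrom-≤-* (suc lo) m λ i lo<i i<lo+m →
     f≤B i (<⇒≤ lo<i) (subst (i <_) (sym (+-suc lo m)) i<lo+m))

Σᶠ-mono : ∀ {K} {f g : Fin K → ℕ} → (∀ k → f k ≤ g k) → Σᶠ f ≤ Σᶠ g
Σᶠ-mono {zero} f≤g = z≤n
Σᶠ-mono {suc K} f≤g = +-mono-≤ (f≤g Fin.zero) (Σᶠ-mono (λ k → f≤g (Fin.suc k)))

Σᶠ-0 : ∀ K → Σᶠ {K} (λ _ → 0) ≡ 0
Σᶠ-0 zero = refl
Σᶠ-0 (suc K) = Σᶠ-0 K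

Σᶠ-+ : ∀ {K} (f g : Fin K → ℕ) → Σᶠ (λ k → f k + g k) ≡ Σᶠ f + Σᶠ g
Σᶠ-+ {zero} f g = refl
Σᶠ-+ {suc K} f g =
  trans (cong (f Fin.zero + g Fin.zero +_) (Σᶠ-+ (λ k → f (Fin.suc k)) (λ k → g (Fin.suc k))))
        (interchange (f Fin.zero) (g Fin.zero) _ _)

Σᶠ-sumFrom : ∀ {K} (g : Fin K → ℕ → ℕ) lo m →
             Σᶠ (λ k → sumFrom (g k) lo m) ≡ sumFrom (λ s → Σᶠ (λ k → g k s)) lo m
Σᶠ-sumFrom {K} g lo zero = Σᶠ-0 K
Σᶠ-sumFrom g lo (suc m) = trans (Σᶠ-+ (λ k → g k lo) (λ k → sumFrom (g k) (suc lo) m))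
                                (cong (Σᶠ (λ k → g k lo) +_) (Σᶠ-sumFrom g (suc lo) m))

∧-true : ∀ {x y} → x ∧ y ≡ true → x ≡ true × y ≡ true
∧-true {true} y≡true = refl , y≡true

≡ᵇ-refl : ∀ m → (m ≡ᵇ m) ≡ true
≡ᵇ-refl m = Equivalence.to T-≡ (≡⇒≡ᵇ m m refl)

≡ᵇ-true : ∀ {m n} → (m ≡ᵇ n) ≡ true → m ≡ n
≡ᵇ-true {m} {n} eq = ≡ᵇ⇒≡ m n (Equivalence.from T-≡ eq)

not-isYes : ∀ {P : Set} (P? : Dec P) → not ⌊ P? ⌋ ≡ true → ¬ P
not-isYes (yes p) ()
not-isYes (no ¬p) _ = ¬p

m+suc[n∸m∸1]≡n : ∀ {m n} → m < n → m + suc (n ∸ m ∸ 1) ≡ n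
m+suc[n∸m∸1]≡n {zero} {suc n} _ = refl
m+suc[n∸m∸1]≡n {suc m} {suc n} (s≤s m<n) = cong suc (m+suc[n∸m∸1]≡n m<n)

module _ {n : ℕ} where

  isAt-true : ∀ {a w : Fin n} {r x} → a ≡ w → r ≡ x → ⌊ a ≟ᶠ w ⌋ ∧ (r ≡ᵇ x) ≡ true
  isAt-true {a} {r = r} refl refl with a ≟ᶠ a
  ... | yes _ = ≡ᵇ-refl r
  ... | no a≢a = contradiction refl a≢a

  isAt-false : ∀ {a w : Fin n} {r x} → ¬ (a ≡ w × r ≡ x) → ⌊ a ≟ᶠ w ⌋ ∧ (r ≡ᵇ x) ≡ false
  isAt-false {a} {w} {r} {x} off with a ≟ᶠ w | r ≡ᵇ x in r≡ᵇx
  ... | no _ | _ = refl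
  ... | yes _ | false = refl
  ... | yes a≡w | true = contradiction (a≡w , ≡ᵇ-true r≡ᵇx) off

maxLE-interval-overlap : ∀ {P : ℕ → Bool} {r r̂ d d̂ t tn} →
                         IsMaxLE P r r̂ → IsMaxLE P d d̂ → P tn ≡ true → r̂ ≤ t → t < d̂ → t < tn →
                         ∃ λ x → r ≤ x × x < d × t ≤ x × x < tn
maxLE-interval-overlap {P} {r} {r̂} {t = t} (_ , _ , r̂-last) (d̂≤d , P-d̂ , _) P-tn r̂≤t t<d̂ t<tn
  with r ≤? t
... | yes r≤t = t , r≤t , <-≤-trans t<d̂ d̂≤d , ≤-refl , t<tn
... | no r≰t = r , ≤-refl , <-≤-trans (beyond (≤-<-trans r̂≤t t<d̂) P-d̂) d̂≤d , <⇒≤ (≰⇒> r≰t) ,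
               beyond (≤-<-trans r̂≤t t<tn) P-tn
  where
    beyond : ∀ {y} → r̂ < y → P y ≡ true → r < y
    beyond {y} r̂<y P-y = ≰⇒> λ y≤r → contradiction (trans (sym P-y) (r̂-last y r̂<y y≤r)) λ ()

indicator≤1 : ∀ b → (if b then 1 else 0) ≤ 1
indicator≤1 true = ≤-refl
indicator≤1 false = z≤n

module Walks (n : ℕ) (A : Fin n → Fin n → Set) (τ u : Fin n → Fin n → ℕ) (b : Fin n → ℕ)
             (K : ℕ) (src dst : Fin K → Fin n) (T : ℕ) where
  open UPR n A τ u b K src dst T

  xHold-hold-≥ : ∀ {a r z s w x} (r<T : r < T) (q : WalkT a (suc r) z s) →
                 xHold q w x ≤ xHold (hold r<T q) w x
  xHold-hold-≥ _ _ = m≤n+m _ _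

  xHold-hold-at : ∀ {a r z s w x} (r<T : r < T) (q : WalkT a (suc r) z s) →
                  a ≡ w → r ≡ x → xHold q w x < xHold (hold r<T q) w x
  xHold-hold-at _ _ a≡w r≡x rewrite isAt-true a≡w r≡x = ≤-refl

  module _ {NS : Fin n → ℕ → Bool} {AS : Fin n → ℕ → Fin n → ℕ → Set} where

    xHoldS-hold-≤ : ∀ {a r r' z s w x} (P : NS a r ≡ true) (r<T : r < T) (next : IsNext (NS a) r r')
                    (q : WalkS NS AS a r' z s) →
                    xHoldS NS AS (hold P r<T next q) w x ≤ suc (xHoldS NS AS q w x)
    xHoldS-hold-≤ {a} {r} {w = w} {x} _ _ _ _ = +-monoˡ-≤ _ (indicator≤1 (⌊ a ≟ᶠ w ⌋ ∧ (r ≡ᵇ x)))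

    xHoldS-hold-off : ∀ {a r r' z s w x} (P : NS a r ≡ true) (r<T : r < T) (next : IsNext (NS a) r r')
                      (q : WalkS NS AS a r' z s) → ¬ (a ≡ w × r ≡ x) →
                      xHoldS NS AS (hold P r<T next q) w x ≡ xHoldS NS AS q w x
    xHoldS-hold-off _ _ _ _ off rewrite isAt-false off = refl

  module HoldWindow (v : Fin n) (lo m : ℕ) where

    holdsIn : ∀ {a r z s} → WalkT a r z s → ℕ
    holdsIn q = sumFrom (xHold q v) lo m

    data FirstMoveT {a r z s} (q : WalkT a r z s) : Set where
      noMoves : movesT q ≡ [] → FirstMoveT q
      firstMove : (d : ℕ) (w : Fin n) (q' : WalkT w (d + τ a w) z s) → r ≤ d →
                  movesT q ≡ tarc a d w (d + τ a w) ∷ movesT q' →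
                  holdsIn q' ≤ holdsIn q →
                  (a ≡ v → ∀ {x} → r ≤ x → x < d → lo ≤ x → x < lo + m → holdsIn q' < holdsIn q) →
                  FirstMoveT q

    firstMoveT : ∀ {a r z s} (q : WalkT a r z s) → FirstMoveT q
    firstMoveT stop = noMoves refl
    firstMoveT {r = r} (move w _ _ q') =
      firstMove r w q' ≤-refl refl ≤-refl (λ _ r≤x x<r _ _ → contradiction x<r (≤⇒≯ r≤x))
    firstMoveT {a} {r} (hold r<T q₁) with firstMoveT q₁
    ... | noMoves none = noMoves none
    ... | firstMove d w q' r<d moves q'≤q₁ hit =
          firstMove d w q' (<⇒≤ r<d) moves (≤-trans q'≤q₁ q₁≤q) hit'
      where
        q₁≤q : holdsIn q₁ ≤ holdsIn (hold r<T q₁)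
        q₁≤q = sumFrom-mono (λ _ → xHold-hold-≥ r<T q₁) lo m

        hit' : a ≡ v → ∀ {x} → r ≤ x → x < d → lo ≤ x → x < lo + m → holdsIn q' < holdsIn (hold r<T q₁)
        hit' a≡v {x} r≤x x<d lo≤x x<lo+m with r ≟ x
        ... | yes r≡x = ≤-trans (s≤s q'≤q₁)
          (sumFrom-mono-< (λ _ → xHold-hold-≥ r<T q₁) lo m lo≤x x<lo+m (xHold-hold-at r<T q₁ a≡v r≡x))
        ... | no r≢x = <-≤-trans (hit a≡v (≤∧≢⇒< r≤x r≢x) x<d lo≤x x<lo+m) q₁≤q

  module HoldAt (NS : Fin n → ℕ → Bool) (AS : Fin n → ℕ → Fin n → ℕ → Set) (v : Fin n) (t : ℕ) where

    holdsAt : ∀ {a r z s} → WalkS NS AS a r z s → ℕ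
    holdsAt q = xHoldS NS AS q v t

    data FirstMoveS {a r z s} (q : WalkS NS AS a r z s) : Set where
      noMoves : z ≡ a → movesS NS AS q ≡ [] → (¬ a ≡ v → holdsAt q ≡ 0) → FirstMoveS q
      firstMove : (d : ℕ) (w : Fin n) (t' : ℕ) (q' : WalkS NS AS w t' z s) → r ≤ d →
                  movesS NS AS q ≡ tarc a d w t' ∷ movesS NS AS q' →
                  holdsAt q ≤ suc (holdsAt q') →
                  (¬ (a ≡ v × r ≤ t × t < d) → holdsAt q ≡ holdsAt q') →
                  FirstMoveS q

    firstMoveS : ∀ {a r z s} (q : WalkS NS AS a r z s) → FirstMoveS q
    firstMoveS stop = noMoves refl refl (λ _ → refl)
    firstMoveS {r = r} (move w t' _ q') = firstMove r w t' q' ≤-refl refl (n≤1+n _) (λ _ → refl)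
    firstMoveS {a} {r} (hold P r<T next@(r<r' , _) q₁) with firstMoveS q₁
    ... | noMoves z≡a none none-at-v =
          noMoves z≡a none (λ a≢v → trans (xHoldS-hold-off P r<T next q₁ (a≢v ∘ proj₁)) (none-at-v a≢v))
    ... | firstMove d w t' q' r'≤d moves ≤suc off =
          firstMove d w t' q' (≤-trans (<⇒≤ r<r') r'≤d) moves bound off'
      where
        off' : ¬ (a ≡ v × r ≤ t × t < d) → holdsAt (hold P r<T next q₁) ≡ holdsAt q'
        off' notIn = trans
          (xHoldS-hold-off P r<T next q₁ λ (a≡v , r≡t) →
             notIn (a≡v , ≤-reflexive r≡t , <-≤-trans (subst (_< _) r≡t r<r') r'≤d))
          (off λ (a≡v , r'≤t , t<d) → notIn (a≡v , ≤-trans (<⇒≤ r<r') r'≤t , t<d))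

        bound : holdsAt (hold P r<T next q₁) ≤ suc (holdsAt q')
        bound with (a ≟ᶠ v) ×-dec (r ≟ t)
        ... | yes (_ , r≡t) = ≤-trans (xHoldS-hold-≤ P r<T next q₁)
          (s≤s (≤-reflexive (off λ (_ , r'≤t , _) → ≤⇒≯ r'≤t (subst (_< _) r≡t r<r'))))
        ... | no off-at = ≤-trans (≤-reflexive (xHoldS-hold-off P r<T next q₁ off-at)) ≤suc

  module PacketBound (NS : Fin n → ℕ → Bool) (AS : Fin n → ℕ → Fin n → ℕ → Set)
                     (v : Fin n) (t m : ℕ) (next-at-v : NS v (t + suc m) ≡ true)
                     {z : Fin n} {s : ℕ} (z≢v : ¬ z ≡ v) where
    open HoldWindow v t (suc m)
    open HoldAt NS AS v t

    same-departure : ∀ {w d d̂} → w ≡ v → (if ⌊ w ≟ᶠ v ⌋ then d ≡ᵇ d̂ else true) ≡ true → d ≡ d̂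
    same-departure {w} w≡v exact with w ≟ᶠ v
    ... | yes _ = ≡ᵇ-true exact
    ... | no w≢v = contradiction w≡v w≢v

    holdsAt≤holdsIn : ∀ {a r r̂} (q : WalkT a r z s) (q̂ : WalkS NS AS a r̂ z s) {xs ys} →
                      Pointwise (MuImage NS AS) xs ys → movesT q ≡ xs → movesS NS AS q̂ ≡ ys →
                      exactInto NS AS v xs ys ≡ true → (a ≡ v → IsMaxLE (NS v) r r̂) →
                      holdsAt q̂ ≤ holdsIn q
    holdsAt≤holdsIn q q̂ [] _ ys≡ _ _ with firstMoveS q̂
    ... | noMoves z≡a _ none-at-v = ≤-trans (≤-reflexive (none-at-v (z≢v ∘ trans z≡a))) z≤n
    ... | firstMove _ _ _ _ _ moves _ _ with trans (sym moves) ys≡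
    ...   | ()
    holdsAt≤holdsIn q q̂ (_ ∷ _) xs≡ ys≡ exact arrival with firstMoveT q | firstMoveS q̂
    ... | noMoves none | _ with trans (sym none) xs≡
    ...   | ()
    holdsAt≤holdsIn q q̂ (_ ∷ _) xs≡ ys≡ exact arrival | _ | noMoves _ none _ with trans (sym none) ys≡
    ...   | ()
    holdsAt≤holdsIn {a} {r} {r̂} q q̂ (μ-arc ∷ μ-rest) xs≡ ys≡ exact arrival
      | firstMove d w q' r≤d movesT≡ q'≤q hit | firstMove d̂ _ t' q̂' r̂≤d̂ movesS≡ ≤suc off
      with trans (sym movesT≡) xs≡ | trans (sym movesS≡) ys≡ | μ-arc
    ... | refl | refl | (_ , refl , dep-max , arr-max) with ∧-true exact
    ...   | first-exact , rest-exact = step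
      where
        arrival' : w ≡ v → IsMaxLE (NS v) (d + τ a w) t'
        arrival' w≡v = subst₂ (λ c e → IsMaxLE (NS c) (e + τ a w) t') w≡v
                              (sym (same-departure w≡v first-exact)) arr-max

        rest : holdsAt q̂' ≤ holdsIn q'
        rest = holdsAt≤holdsIn q' q̂' μ-rest refl refl rest-exact arrival'

        step : holdsAt q̂ ≤ holdsIn q
        step with (a ≟ᶠ v) ×-dec (r̂ ≤? t) ×-dec (t <? d̂)
        ... | yes (a≡v , r̂≤t , t<d̂) =
              let x , r≤x , x<d , t≤x , x<tn =
                    maxLE-interval-overlap (arrival a≡v) (subst (λ c → IsMaxLE (NS c) d d̂) a≡v dep-max)
                                           next-at-v r̂≤t t<d̂ (m<m+n t z<s)
              in ≤-trans ≤suc (≤-trans (s≤s rest) (hit a≡v r≤x x<d t≤x x<tn))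
        ... | no notIn = ≤-trans (≤-reflexive (off notIn)) (≤-trans rest q'≤q)

  stored : Trajectories → Fin n → Fin K → ℕ → ℕ
  stored Q v k s = if inKv v k then xHold (Q k) v s else 0

  module _ (NS : Fin n → ℕ → Bool) (AS : Fin n → ℕ → Fin n → ℕ → Set)
           (Q : Trajectories) (Q̂ : (k : Fin K) → WalkS NS AS (src k) 0 (dst k) T)
           (μ : ∀ k → IsMu NS AS (Q k) (Q̂ k)) where

    holdsS≤storedWindow : ∀ v t m → NS v (t + suc m) ≡ true → ∀ k → inK1 NS AS Q Q̂ v k ≡ true →
                          xHoldS NS AS (Q̂ k) v t ≤ xHold (Q k) v t + sumFrom (stored Q v k) (suc t) m
    holdsS≤storedWindow v t m next-at-v k inK1≡ with ∧-true inK1≡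
    ... | inKv≡ , visits-exact with ∧-true inKv≡ | ∧-true visits-exact
    ...   | src≢v , dst≢v | _ , exact =
            ≤-trans (holdsAt≤holdsIn (Q k) (Q̂ k) (μ k) refl refl exact departure)
                    (+-monoʳ-≤ _ (sumFrom-mono stored-all (suc t) m))
      where
        open PacketBound NS AS v t m next-at-v (not-isYes (dst k ≟ᶠ v) dst≢v)

        departure : src k ≡ v → IsMaxLE (NS v) 0 0
        departure src≡v = contradiction src≡v (not-isYes (src k ≟ᶠ v) src≢v)

        stored-all : ∀ s → xHold (Q k) v s ≤ stored Q v k s
        stored-all s = ≤-reflexive (cong (λ c → if c then xHold (Q k) v s else 0) (sym inKv≡))

lemma4 : (n : ℕ) (A : Fin n → Fin n → Set) (τ u : Fin n → Fin n → ℕ) (b : Fin n → ℕ)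
         (K : ℕ) (src dst : Fin K → Fin n) (T : ℕ) →
         let open UPR n A τ u b K src dst T in
         (NS : Fin n → ℕ → Bool) (AS : Fin n → ℕ → Fin n → ℕ → Set) → PTEN NS AS →
         (Q : Trajectories) → Feasible Q →
         (Q̂ : (k : Fin K) → WalkS NS AS (src k) 0 (dst k) T) →
         (∀ k → IsMu NS AS (Q k) (Q̂ k)) →
         (v : Fin n) (t tn : ℕ) → NS v t ≡ true → t < T → IsNext (NS v) t tn →
         Σᶠ (λ k → if inK1 NS AS Q Q̂ v k then xHoldS NS AS (Q̂ k) v t else 0)
           ≤ Σᶠ (λ k → if inK1 NS AS Q Q̂ v k then xHold (Q k) v t else 0)
             + (tn ∸ t ∸ 1) * b v
lemma4 n A τ u b K src dst T NS AS pten Q feas Q̂ μ v t tn _ _ (t<tn , next-at-v , _) = begin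
  Σᶠ (λ k → onK¹ k (xHoldS NS AS (Q̂ k) v t))
    ≤⟨ Σᶠ-mono per-packet ⟩
  Σᶠ (λ k → holdAt-t k + storedLater k)
    ≡⟨ Σᶠ-+ holdAt-t storedLater ⟩
  Σᶠ holdAt-t + Σᶠ storedLater
    ≡⟨ cong (Σᶠ holdAt-t +_) (Σᶠ-sumFrom (stored Q v) (suc t) m) ⟩
  Σᶠ holdAt-t + sumFrom (λ s → Σᶠ (λ k → stored Q v k s)) (suc t) m
    ≤⟨ +-monoʳ-≤ _ (sumFrom-≤-* (suc t) m storage) ⟩
  Σᶠ holdAt-t + m * b v ∎
  where
    open UPR n A τ u b K src dst T
    open Walks n A τ u b K src dst T
    open ≤-Reasoning

    m : ℕ
    m = tn ∸ t ∸ 1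

    tn≡ : t + suc m ≡ tn
    tn≡ = m+suc[n∸m∸1]≡n t<tn

    onK¹ : Fin K → ℕ → ℕ
    onK¹ k x = if inK1 NS AS Q Q̂ v k then x else 0

    holdAt-t storedLater : Fin K → ℕ
    holdAt-t k = onK¹ k (xHold (Q k) v t)
    storedLater k = sumFrom (stored Q v k) (suc t) m

    per-packet : ∀ k → onK¹ k (xHoldS NS AS (Q̂ k) v t) ≤ holdAt-t k + storedLater k
    per-packet k with inK1 NS AS Q Q̂ v k in inK1≡
    ... | true = holdsS≤storedWindow NS AS Q Q̂ μ v t m (subst (λ c → NS v c ≡ true) (sym tn≡) next-at-v)
                                     k inK1≡
    ... | false = z≤n

    storage : ∀ s → suc t ≤ s → s < suc t + m → Σᶠ (λ k → stored Q v k s) ≤ b v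
    storage s _ s<tn = Feasible.holdCap feas v s
      (<-≤-trans (subst (s <_) (trans (sym (+-suc t m)) tn≡) s<tn) (PTEN.NS⊆NT pten v tn next-at-v))
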